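{- Let $G=(V,E)$ be an undirected graph on $n$ vertices with positive edge weights $w:E\to\mathbb{R}_{+}$, and let $k$ be an integer with $1\le k\le n$. Then the algorithm $ChALK(G,k)$ returns an induced subgraph $H$ of $G$ with at least $k$ vertices and density $d(H)\ge \mathrm{dal}(G,k)/3$. That is, $ChALK$ is a $3$-approximation algorithm for the densest at-least-$k$-subgraph problem.
   Context: For an induced subgraph $H$ of $G$: the weighted degree $w(v,H)$ of a vertex $v$ in $H$ is the sum of the weights of the edges of $H$ incident with $v$; $W(H)$ is the sum of the weights of the edges of $H$; $|H|$ is the number of vertices of $H$; and the density of $H$ is $d(H)=W(H)/|H|$. $\mathrm{dal}(G,k)$ denotes the maximum density of an induced subgraph of $G$ with at least $k$ vertices. The algorithm $ChALK(G,k)$ is: set $H_n=G$; for $i=n,n-1,\dots,1$, let $r_i$ be the minimum weighted degree of a vertex in $H_i$, let $v_i$ be a vertex (chosen arbitrarily among ties) with $w(v_i,H_i)=r_i$, and let $H_{i-1}$ be the induced subgraph obtained by removing $v_i$ from $H_i$ (so $H_i$ has exactly $i$ vertices). Then compute $d(H_i)$ for every $i\in[1,n]$ and output the $H_i$ with $i\ge k$ maximizing $d(H_i)$.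
   Formalization: The edge weights are positive rationals rather than elements of ℝ₊. -}

module Defs where

open import Data.Bool using (Bool; true; false; if_then_else_; _∧_)
open import Data.Nat as ℕ using (ℕ; zero; suc; _<ᵇ_)
open import Data.Fin using (Fin; toℕ)
open import Data.List using (List; []; _∷_; map; foldr; _++_)
open import Data.List.Base using (allFin)
open import Data.Vec using (Vec; []; _∷_; lookup)
open import Data.Fin.Subset using (Subset; ∣_∣; ⊤; ⁅_⁆; _─_)
open import Data.Integer using (+_)
open import Data.Rational using (ℚ; 0ℚ; _+_; _*_; _/_; _<_; _≤_; _⊔_)
open import Data.Product using (Σ; _×_)
open import Relation.Binary.PropositionalEquality using (_≡_)

-- An undirected simple graph on vertex set Fin n with positive edge weights.
-- adj i j ≡ true  means {i,j} ∈ E; weights w are only relevant on edges,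
-- where they are required to be strictly positive.
record WGraph (n : ℕ) : Set where
  field
    adj       : Fin n → Fin n → Bool
    adj-sym   : ∀ i j → adj i j ≡ adj j i
    adj-irr   : ∀ i → adj i i ≡ false
    w         : Fin n → Fin n → ℚ
    w-sym     : ∀ i j → w i j ≡ w j i
    w-pos     : ∀ i j → adj i j ≡ true → 0ℚ < w i j
open WGraph public

sumℚ : List ℚ → ℚ
sumℚ = foldr _+_ 0ℚ

-- Induced subgraphs are given by their vertex sets S : Subset n.
-- weighted degree w(v,H): sum of weights of edges of H incident with v
wdeg : ∀ {n} → WGraph n → Fin n → Subset n → ℚ
wdeg G v S = sumℚ (map (λ u → if lookup S u ∧ adj G v u then w G v u else 0ℚ) (allFin _))

totalW : ∀ {n} → WGraph n → Subset n → ℚ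
totalW {n} G S =
  sumℚ (map (λ i → sumℚ (map (λ j →
     if (toℕ i <ᵇ toℕ j) ∧ lookup S i ∧ lookup S j ∧ adj G i j
     then w G i j else 0ℚ) (allFin n))) (allFin n))

-- 1/m as a rational (with the convention 1/0 = 0; only used for |H| ≥ 1)
inv : ℕ → ℚ
inv zero    = 0ℚ
inv (suc m) = (+ 1) / suc m

density : ∀ {n} → WGraph n → Subset n → ℚ
density G S = totalW G S * inv ∣ S ∣

allSubsets : (n : ℕ) → List (Subset n)
allSubsets zero    = [] ∷ []
allSubsets (suc n) = map (true ∷_) (allSubsets n) ++ map (false ∷_) (allSubsets n)

-- dal(G,k): maximum density of an induced subgraph with at least k vertices.
-- (The fold starts at 0, harmless since all densities are ≥ 0 and, for
-- 1 ≤ k ≤ n, the list of candidates is nonempty.)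
dal : ∀ {n} → WGraph n → ℕ → ℚ
dal {n} G k =
  foldr (λ S m → if k ℕ.≤ᵇ ∣ S ∣ then density G S ⊔ m else m) 0ℚ (allSubsets n)

-- A run of ChALK(G,·): H i is the graph H_i (|H_i| = i).
record ChALKRun {n} (G : WGraph n) (H : ℕ → Subset n) : Set where
  field
    start : H n ≡ ⊤
    step  : ∀ i → suc i ℕ.≤ n →
      Σ (Fin n) λ v →
        (lookup (H (suc i)) v ≡ true)
        × (∀ u → lookup (H (suc i)) u ≡ true →
             wdeg G v (H (suc i)) ≤ wdeg G u (H (suc i)))
        × (H i ≡ H (suc i) ─ ⁅ v ⁆)

record ChALKOutput {n} (G : WGraph n) (k : ℕ) (H : ℕ → Subset n) (i : ℕ) : Set where
  field
    k≤i : k ℕ.≤ i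
    i≤n : i ℕ.≤ n
    best : ∀ j → k ℕ.≤ j → j ℕ.≤ n → density G (H j) ≤ density G (H i)

-- Fix S with |S| ≥ k, put t = d(S)/3 and follow the run from H_n = G down to H_k, watching the
-- excess W(S ∩ H_i) − 2t·|S ∩ H_i|. If some deleted vertex v_{i+1} has degree ≥ 2t in H_{i+1},
-- then so does every vertex of H_{i+1} (v_{i+1} has minimum degree), and the handshake identity
-- 2W = Σ degrees gives d(H_{i+1}) ≥ t. Otherwise each deletion removes from S ∩ H_{i+1} at most
-- one vertex, of degree < 2t there: W drops by that degree and 2t·|S ∩ H| by 2t, so the excess
-- never drops and W(H_k) ≥ W(S ∩ H_k) ≥ W(S) − 2t|S| = t|S| ≥ t|H_k|. Either way some H_j with
-- j ≥ k has density ≥ d(S)/3, hence so does the output.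

module Submission where

open import Defs
open import Data.Nat using (ℕ; _≤_)
open import Data.Fin.Subset using (Subset; ∣_∣)
open import Data.Product using (_×_)
open import Data.Integer using (+_)
open import Data.Rational as ℚ using (_*_; _/_)

open import Algebra.Bundles using (CommutativeRing)
open import Data.Bool.Base using (Bool; true; false; if_then_else_; _∧_; T)
open import Data.Bool.Properties using (∧-zeroʳ)
open import Data.Fin.Base using (Fin; zero; suc; toℕ)
open import Data.Fin.Properties using (toℕ-injective)
open import Data.Fin.Subset using (⁅_⁆; _─_; _∩_; ⊥; _⊆_)
open import Data.Fin.Subset.Properties using (p─⊥≡p; p∩q⊆q; ∩-identityʳ; ∣⊤∣≡n)
import Data.Integer as ℤ
import Data.Integer.Properties as ℤₚ
open import Data.List.Base using (List; []; _∷_; foldr; map; allFin; tabulate)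
import Data.List.Properties as List
import Data.Nat as ℕ
open import Data.Nat.Base using (zero; suc; z≤n; _<_; _∸_; _<ᵇ_)
import Data.Nat.Coprimality as Coprime
import Data.Nat.Properties as ℕₚ
open import Data.Product using (∃-syntax; _,_)
open import Data.Rational.Base using (ℚ; mkℚ; 0ℚ; 1ℚ; _+_; _-_; *≤*)
open import Data.Rational.Properties as ℚ
  using (*-identityˡ; *-identityʳ; *-zeroˡ; *-zeroʳ; +-identityˡ; +-identityʳ)
open import Data.Rational.Solver using (module +-*-Solver)
import Data.Rational.Unnormalised.Base as ℚᵘ
import Data.Rational.Unnormalised.Properties as ℚᵘₚ
open import Data.Sum using (_⊎_; inj₁; inj₂)
open import Data.Vec.Base using ([]; _∷_; lookup)
open import Data.Vec.Properties using (lookup-replicate; []=⇒lookup; lookup⇒[]=)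
open import Function using (_∘_)
open import Relation.Binary.PropositionalEquality
open import Relation.Nullary.Decidable using (yes; no)
open import Relation.Nullary.Negation using (contradiction)
open import Relation.Nullary.Reflects using (ofʸ; ofⁿ)

open import Algebra.Properties.CommutativeSemigroup (CommutativeRing.*-commutativeSemigroup ℚ.+-*-commutativeRing)
  using (x∙yz≈y∙xz)
open import Algebra.Properties.CommutativeSemigroup (CommutativeRing.+-commutativeSemigroup ℚ.+-*-commutativeRing)
  using () renaming (interchange to +-interchange)
open import Algebra.Properties.Semiring.Sum (CommutativeRing.semiring ℚ.+-*-commutativeRing)
  using (sum; sum-syntax; sum-cong-≗; sum-replicate-zero; ∑-distrib-+; ∑-comm; *-distribˡ-sum)
open +-*-Solver using (solve; _:+_; _:*_; _:-_; _:=_; con)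

fromℕ : ℕ → ℚ
fromℕ m = mkℚ (+ m) 0 (Coprime.sym (Coprime.1-coprimeTo m))

fromℕ-suc : ∀ m → fromℕ (suc m) ≡ 1ℚ + fromℕ m
fromℕ-suc m =
  ℚ.toℚᵘ-injective (ℚᵘₚ.≃-sym (ℚᵘₚ.≃-trans (ℚ.toℚᵘ-homo-+ 1ℚ (fromℕ m)) (ℚᵘ.*≡* 1+m≡suc-m)))
  where
  1+m≡suc-m : (+ 1 ℤ.+ + m ℤ.* + 1) ℤ.* + 1 ≡ + suc m ℤ.* + 1
  1+m≡suc-m = cong (λ x → (+ 1 ℤ.+ x) ℤ.* + 1) (ℤₚ.*-identityʳ (+ m))

fromℕ-mono : ∀ {m n} → m ≤ n → fromℕ m ℚ.≤ fromℕ n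
fromℕ-mono m≤n = *≤* (ℤₚ.*-monoʳ-≤-nonNeg (+ 1) (ℤ.+≤+ m≤n))

-- normalize-coprime identifies inv (suc m) with 1/ fromℕ (suc m).
fromℕ-*-inv : ∀ m → 1 ≤ m → fromℕ m * inv m ≡ 1ℚ
fromℕ-*-inv (suc m) _ rewrite ℚ.normalize-coprime {1} {m} (Coprime.1-coprimeTo (suc m)) =
  ℚ.*-inverseʳ (fromℕ (suc m))

fromℕ-*-*-inv : ∀ {m} → 1 ≤ m → ∀ x → fromℕ m * (x * inv m) ≡ x
fromℕ-*-*-inv {m} 1≤m x = begin
  fromℕ m * (x * inv m) ≡⟨ x∙yz≈y∙xz (fromℕ m) x (inv m) ⟩
  x * (fromℕ m * inv m) ≡⟨ cong (x *_) (fromℕ-*-inv m 1≤m) ⟩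
  x * 1ℚ                ≡⟨ *-identityʳ x ⟩
  x                     ∎
  where open ≡-Reasoning

fromℕ-nonneg : ∀ m → 0ℚ ℚ.≤ fromℕ m
fromℕ-nonneg m = fromℕ-mono z≤n

x-y≤x : ∀ {x y} → 0ℚ ℚ.≤ y → x - y ℚ.≤ x
x-y≤x {x} 0≤y = subst (x - _ ℚ.≤_) (+-identityʳ x) (ℚ.+-monoʳ-≤ x (ℚ.neg-antimono-≤ 0≤y))

inv-nonneg : ∀ m → 0ℚ ℚ.≤ inv m
inv-nonneg zero    = ℚ.≤-refl
inv-nonneg (suc m) = ℚ.nonNegative⁻¹ _ {{ℚ.normalize-nonNeg 1 (suc m)}}

*-nonneg : ∀ {x y} → 0ℚ ℚ.≤ x → 0ℚ ℚ.≤ y → 0ℚ ℚ.≤ x * y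
*-nonneg {x} {y} 0≤x 0≤y =
  ℚ.nonNegative⁻¹ _ {{ℚ.nonNeg*nonNeg⇒nonNeg x {{ℚ.nonNegative 0≤x}} y {{ℚ.nonNegative 0≤y}}}}

+-double-cancel-≤ : ∀ {x y} → x + x ℚ.≤ y + y → x ℚ.≤ y
+-double-cancel-≤ x+x≤y+y = ℚ.≮⇒≥ λ y<x → ℚ.<-irrefl refl (ℚ.<-≤-trans (ℚ.+-mono-< y<x y<x) x+x≤y+y)

+-double-injective : ∀ {x y} → x + x ≡ y + y → x ≡ y
+-double-injective e =
  ℚ.≤-antisym (+-double-cancel-≤ (ℚ.≤-reflexive e)) (+-double-cancel-≤ (ℚ.≤-reflexive (sym e)))

downward-induction : ∀ {n} (P : ℕ → Set) → P n → (∀ {i} → i < n → P (suc i) → P i) →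
                     ∀ {i} → i ≤ n → P i
downward-induction {n} P Pn step {i} i≤n = go (n ∸ i) (ℕₚ.m+[n∸m]≡n i≤n)
  where
  go : ∀ k {i} → i ℕ.+ k ≡ n → P i
  go zero    {i} i+0≡n = subst P (sym (trans (sym (ℕₚ.+-identityʳ i)) i+0≡n)) Pn
  go (suc k) {i} i+1+k≡n =
    step (subst (i <_) i+1+k≡n (ℕₚ.m<m+n i ℕ.z<s)) (go k (trans (sym (ℕₚ.+-suc i k)) i+1+k≡n))

𝟙 : Bool → ℚ
𝟙 true  = 1ℚ
𝟙 false = 0ℚ

𝟙-nonneg : ∀ b → 0ℚ ℚ.≤ 𝟙 b
𝟙-nonneg true  = ℚ.≤ᵇ⇒≤ _
𝟙-nonneg false = ℚ.≤-refl

if-∧-then-else-0 : ∀ x y (q : ℚ) → (if x ∧ y then q else 0ℚ) ≡ 𝟙 x * (if y then q else 0ℚ)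
if-∧-then-else-0 true  y q = sym (*-identityˡ _)
if-∧-then-else-0 false y q = sym (*-zeroˡ (if y then q else 0ℚ))

𝟙-*-mono-≤ : ∀ b {x y} → (b ≡ true → x ℚ.≤ y) → 𝟙 b * x ℚ.≤ 𝟙 b * y
𝟙-*-mono-≤ true  x≤y = ℚ.*-monoˡ-≤-nonNeg 1ℚ (x≤y refl)
𝟙-*-mono-≤ false {x} {y} _ = ℚ.≤-reflexive (trans (*-zeroˡ x) (sym (*-zeroˡ y)))

sumℚ-allFin : ∀ n (f : Fin n → ℚ) → sumℚ (map f (allFin n)) ≡ ∑[ i < n ] f i
sumℚ-allFin n f = trans (cong sumℚ (List.map-tabulate (λ i → i) f)) (sumℚ-tabulate n f)
  where
  sumℚ-tabulate : ∀ n (f : Fin n → ℚ) → sumℚ (tabulate f) ≡ ∑[ i < n ] f i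
  sumℚ-tabulate zero    f = refl
  sumℚ-tabulate (suc n) f = cong (_+_ (f zero)) (sumℚ-tabulate n (λ i → f (suc i)))

∑-mono-≤ : ∀ {n} {f g : Fin n → ℚ} → (∀ i → f i ℚ.≤ g i) → ∑[ i < n ] f i ℚ.≤ ∑[ i < n ] g i
∑-mono-≤ {zero}  f≤g = ℚ.≤-refl
∑-mono-≤ {suc n} f≤g = ℚ.+-mono-≤ (f≤g zero) (∑-mono-≤ (λ i → f≤g (suc i)))

∑-nonneg : ∀ {n} {f : Fin n → ℚ} → (∀ i → 0ℚ ℚ.≤ f i) → 0ℚ ℚ.≤ ∑[ i < n ] f i
∑-nonneg {n} {f} 0≤f = subst (ℚ._≤ sum f) (sum-replicate-zero n) (∑-mono-≤ 0≤f)

∑-⊥ : ∀ {n} (f : Fin n → ℚ) → ∑[ u < n ] (𝟙 (lookup (⊥ {n}) u) * f u) ≡ 0ℚ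
∑-⊥ {n} f = trans (sum-cong-≗ (λ u → trans (cong (λ b → 𝟙 b * f u) (lookup-replicate u false)) (*-zeroˡ (f u))))
                  (sum-replicate-zero n)

∑-⁅⁆ : ∀ {n} (v : Fin n) (f : Fin n → ℚ) → ∑[ u < n ] (𝟙 (lookup ⁅ v ⁆ u) * f u) ≡ f v
∑-⁅⁆ zero    f = trans (cong₂ _+_ (*-identityˡ (f zero)) (∑-⊥ (λ u → f (suc u)))) (+-identityʳ (f zero))
∑-⁅⁆ (suc v) f = trans (cong₂ _+_ (*-zeroˡ (f zero)) (∑-⁅⁆ v (λ u → f (suc u)))) (+-identityˡ (f (suc v)))

∩-─-assoc : ∀ {n} (s p q : Subset n) → s ∩ (p ─ q) ≡ (s ∩ p) ─ q
∩-─-assoc []      []      []          = refl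
∩-─-assoc (x ∷ s) (y ∷ p) (true ∷ q)  = cong₂ _∷_ (∧-zeroʳ x) (∩-─-assoc s p q)
∩-─-assoc (x ∷ s) (y ∷ p) (false ∷ q) = cong (x ∧ y ∷_) (∩-─-assoc s p q)

∣p∣≡1+∣p─⁅v⁆∣ : ∀ {n} (p : Subset n) {v} → lookup p v ≡ true → ∣ p ∣ ≡ suc ∣ p ─ ⁅ v ⁆ ∣
∣p∣≡1+∣p─⁅v⁆∣ (true  ∷ p) {zero}  _   = cong (suc ∘ ∣_∣) (sym (p─⊥≡p p))
∣p∣≡1+∣p─⁅v⁆∣ (true  ∷ p) {suc v} v∈p = cong suc (∣p∣≡1+∣p─⁅v⁆∣ p v∈p)
∣p∣≡1+∣p─⁅v⁆∣ (false ∷ p) {suc v} v∈p = ∣p∣≡1+∣p─⁅v⁆∣ p v∈p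

𝟙-mono-⊆ : ∀ {n} {p q : Subset n} → p ⊆ q → ∀ u → 𝟙 (lookup p u) ℚ.≤ 𝟙 (lookup q u)
𝟙-mono-⊆ {p = p} {q} p⊆q u with lookup p u in u∈p
... | true  rewrite []=⇒lookup (p⊆q (lookup⇒[]= u p u∈p)) = ℚ.≤-refl
... | false = 𝟙-nonneg (lookup q u)

𝟙-─⁅⁆ : ∀ {n} (p : Subset n) (v u : Fin n) →
  𝟙 (lookup p u) ≡ 𝟙 (lookup (p ─ ⁅ v ⁆) u) + 𝟙 (lookup p v) * 𝟙 (lookup ⁅ v ⁆ u)
𝟙-─⁅⁆ (x ∷ p) zero    zero    = sym (trans (+-identityˡ (𝟙 x * 1ℚ)) (*-identityʳ (𝟙 x)))
𝟙-─⁅⁆ (x ∷ p) zero    (suc u) = sym (begin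
  𝟙 (lookup (p ─ ⊥) u) + 𝟙 x * 𝟙 (lookup ⊥ u)
    ≡⟨ cong₂ (λ q b → 𝟙 (lookup q u) + 𝟙 x * 𝟙 b) (p─⊥≡p p) (lookup-replicate u false) ⟩
  𝟙 (lookup p u) + 𝟙 x * 0ℚ
    ≡⟨ cong (_+_ (𝟙 (lookup p u))) (*-zeroʳ (𝟙 x)) ⟩
  𝟙 (lookup p u) + 0ℚ
    ≡⟨ +-identityʳ (𝟙 (lookup p u)) ⟩
  𝟙 (lookup p u) ∎)
  where open ≡-Reasoning
𝟙-─⁅⁆ (x ∷ p) (suc v) zero    =
  sym (trans (cong (_+_ (𝟙 x)) (*-zeroʳ (𝟙 (lookup p v)))) (+-identityʳ (𝟙 x)))
𝟙-─⁅⁆ (x ∷ p) (suc v) (suc u) = 𝟙-─⁅⁆ p v u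

∑-─⁅⁆ : ∀ {n} (p : Subset n) (v : Fin n) (f : Fin n → ℚ) →
  ∑[ u < n ] (𝟙 (lookup p u) * f u) ≡
  ∑[ u < n ] (𝟙 (lookup (p ─ ⁅ v ⁆) u) * f u) + 𝟙 (lookup p v) * f v
∑-─⁅⁆ {n} p v f = begin
  ∑[ u < n ] (𝟙 (lookup p u) * f u)           ≡⟨ sum-cong-≗ split ⟩
  ∑[ u < n ] (g u + t * (δ u * f u))          ≡⟨ ∑-distrib-+ g (λ u → t * (δ u * f u)) ⟩
  ∑[ u < n ] g u + ∑[ u < n ] (t * (δ u * f u)) ≡⟨ cong (_+_ (sum g)) (*-distribˡ-sum t (λ u → δ u * f u)) ⟨
  ∑[ u < n ] g u + t * ∑[ u < n ] (δ u * f u)   ≡⟨ cong (λ s → sum g + t * s) (∑-⁅⁆ v f) ⟩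
  ∑[ u < n ] g u + t * f v                      ∎
  where
  open ≡-Reasoning
  p′ = p ─ ⁅ v ⁆
  t = 𝟙 (lookup p v)
  δ g : Fin n → ℚ
  δ u = 𝟙 (lookup ⁅ v ⁆ u)
  g u = 𝟙 (lookup p′ u) * f u
  split : ∀ u → 𝟙 (lookup p u) * f u ≡ g u + t * (δ u * f u)
  split u = begin
    𝟙 (lookup p u) * f u                  ≡⟨ cong (_* f u) (𝟙-─⁅⁆ p v u) ⟩
    (𝟙 (lookup p′ u) + t * δ u) * f u      ≡⟨ ℚ.*-distribʳ-+ (f u) (𝟙 (lookup p′ u)) (t * δ u) ⟩
    g u + t * δ u * f u                   ≡⟨ cong (_+_ (g u)) (ℚ.*-assoc t (δ u) (f u)) ⟩
    g u + t * (δ u * f u)                 ∎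

∑-𝟙 : ∀ {n} (p : Subset n) (c : ℚ) → ∑[ u < n ] (𝟙 (lookup p u) * c) ≡ fromℕ ∣ p ∣ * c
∑-𝟙 []          c = sym (*-zeroˡ c)
∑-𝟙 (true ∷ p)  c = begin
  1ℚ * c + ∑[ u < _ ] (𝟙 (lookup p u) * c)  ≡⟨ cong₂ _+_ (*-identityˡ c) (∑-𝟙 p c) ⟩
  c + fromℕ ∣ p ∣ * c                        ≡⟨ cong (_+ fromℕ ∣ p ∣ * c) (*-identityˡ c) ⟨
  1ℚ * c + fromℕ ∣ p ∣ * c                   ≡⟨ ℚ.*-distribʳ-+ c 1ℚ (fromℕ ∣ p ∣) ⟨
  (1ℚ + fromℕ ∣ p ∣) * c                     ≡⟨ cong (_* c) (fromℕ-suc ∣ p ∣) ⟨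
  fromℕ (suc ∣ p ∣) * c                      ∎
  where open ≡-Reasoning
∑-𝟙 (false ∷ p) c = begin
  0ℚ * c + ∑[ u < _ ] (𝟙 (lookup p u) * c)  ≡⟨ cong (_+ sum (λ u → 𝟙 (lookup p u) * c)) (*-zeroˡ c) ⟩
  0ℚ + ∑[ u < _ ] (𝟙 (lookup p u) * c)      ≡⟨ +-identityˡ _ ⟩
  ∑[ u < _ ] (𝟙 (lookup p u) * c)           ≡⟨ ∑-𝟙 p c ⟩
  fromℕ ∣ p ∣ * c                           ∎
  where open ≡-Reasoning

fromℕ-∣─⁅⁆∣ : ∀ {n} (p : Subset n) v c →
  fromℕ ∣ p ∣ * c ≡ fromℕ ∣ p ─ ⁅ v ⁆ ∣ * c + 𝟙 (lookup p v) * c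
fromℕ-∣─⁅⁆∣ p v c = begin
  fromℕ ∣ p ∣ * c                                                   ≡⟨ ∑-𝟙 p c ⟨
  ∑[ u < _ ] (𝟙 (lookup p u) * c)                                   ≡⟨ ∑-─⁅⁆ p v (λ _ → c) ⟩
  ∑[ u < _ ] (𝟙 (lookup (p ─ ⁅ v ⁆) u) * c) + 𝟙 (lookup p v) * c    ≡⟨ cong (_+ 𝟙 (lookup p v) * c) (∑-𝟙 (p ─ ⁅ v ⁆) c) ⟩
  fromℕ ∣ p ─ ⁅ v ⁆ ∣ * c + 𝟙 (lookup p v) * c                      ∎
  where open ≡-Reasoning

∑upper : ∀ {n} → (Fin n → Fin n → ℚ) → ℚ
∑upper {n} f = ∑[ a < n ] ∑[ b < n ] (𝟙 (toℕ a <ᵇ toℕ b) * f a b)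

module _ {n} (f : Fin n → Fin n → ℚ) (f-sym : ∀ a b → f a b ≡ f b a) (f-diag : ∀ a → f a a ≡ 0ℚ) where

  private
    split : ∀ a b → f a b ≡ 𝟙 (toℕ a <ᵇ toℕ b) * f a b + 𝟙 (toℕ b <ᵇ toℕ a) * f b a
    split a b with toℕ a <ᵇ toℕ b | ℕₚ.<ᵇ-reflects-< (toℕ a) (toℕ b)
                 | toℕ b <ᵇ toℕ a | ℕₚ.<ᵇ-reflects-< (toℕ b) (toℕ a)
    ... | true  | ofʸ a<b | true  | ofʸ b<a = contradiction b<a (ℕₚ.<-asym a<b)
    ... | true  | _       | false | _       =
      sym (trans (cong₂ _+_ (*-identityˡ (f a b)) (*-zeroˡ (f b a))) (+-identityʳ (f a b)))
    ... | false | _       | true  | _       =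
      sym (trans (cong₂ _+_ (*-zeroˡ (f a b)) (*-identityˡ (f b a))) (trans (+-identityˡ (f b a)) (f-sym b a)))
    ... | false | ofⁿ a≮b | false | ofⁿ b≮a
      with toℕ-injective (ℕₚ.≤-antisym (ℕₚ.≮⇒≥ b≮a) (ℕₚ.≮⇒≥ a≮b))
    ...   | refl =
      sym (trans (cong₂ _+_ (*-zeroˡ (f a a)) (*-zeroˡ (f a a))) (trans (+-identityʳ 0ℚ) (sym (f-diag a))))

  ∑∑-symmetric : ∑[ a < n ] ∑[ b < n ] f a b ≡ ∑upper f + ∑upper f
  ∑∑-symmetric = begin
    ∑[ a < n ] ∑[ b < n ] f a b
      ≡⟨ sum-cong-≗ (λ a → sum-cong-≗ (split a)) ⟩
    ∑[ a < n ] ∑[ b < n ] (upper a b + lower a b)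
      ≡⟨ sum-cong-≗ (λ a → ∑-distrib-+ (upper a) (lower a)) ⟩
    ∑[ a < n ] (∑[ b < n ] upper a b + ∑[ b < n ] lower a b)
      ≡⟨ ∑-distrib-+ (λ a → ∑[ b < n ] upper a b) (λ a → ∑[ b < n ] lower a b) ⟩
    ∑upper f + ∑[ a < n ] ∑[ b < n ] lower a b
      ≡⟨ cong (_+_ (∑upper f)) (∑-comm lower) ⟩
    ∑upper f + ∑upper f ∎
    where
    open ≡-Reasoning
    upper lower : Fin n → Fin n → ℚ
    upper a b = 𝟙 (toℕ a <ᵇ toℕ b) * f a b
    lower a b = upper b a

module _ {n} (G : WGraph n) where

  weight : Fin n → Fin n → ℚ
  weight a b = if adj G a b then w G a b else 0ℚ

  weight-sym : ∀ a b → weight a b ≡ weight b a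
  weight-sym a b = cong₂ (λ e x → if e then x else 0ℚ) (adj-sym G a b) (w-sym G a b)

  weight-diag : ∀ a → weight a a ≡ 0ℚ
  weight-diag a = cong (λ e → if e then w G a a else 0ℚ) (adj-irr G a)

  weight-nonneg : ∀ a b → 0ℚ ℚ.≤ weight a b
  weight-nonneg a b with adj G a b in e
  ... | true  = ℚ.<⇒≤ (w-pos G a b e)
  ... | false = ℚ.≤-refl

  wdeg-∑ : ∀ v S → wdeg G v S ≡ ∑[ u < n ] (𝟙 (lookup S u) * weight v u)
  wdeg-∑ v S = trans (sumℚ-allFin n _) (sum-cong-≗ λ u → if-∧-then-else-0 (lookup S u) (adj G v u) (w G v u))

  totalW-∑upper : ∀ S → totalW G S ≡ ∑upper (λ a b → 𝟙 (lookup S a) * (𝟙 (lookup S b) * weight a b))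
  totalW-∑upper S = trans (sumℚ-allFin n _) (sum-cong-≗ λ a → trans (sumℚ-allFin n _) (sum-cong-≗ λ b →
    trans (if-∧-then-else-0 (toℕ a <ᵇ toℕ b) _ (w G a b)) (cong (𝟙 (toℕ a <ᵇ toℕ b) *_)
    (trans (if-∧-then-else-0 (lookup S a) _ (w G a b)) (cong (𝟙 (lookup S a) *_)
           (if-∧-then-else-0 (lookup S b) (adj G a b) (w G a b)))))))

  handshake : ∀ S → totalW G S + totalW G S ≡ ∑[ a < n ] (𝟙 (lookup S a) * wdeg G a S)
  handshake S = begin
    totalW G S + totalW G S
      ≡⟨ cong₂ _+_ (totalW-∑upper S) (totalW-∑upper S) ⟩
    ∑upper F + ∑upper F
      ≡⟨ ∑∑-symmetric F F-sym F-diag ⟨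
    ∑[ a < n ] ∑[ b < n ] F a b
      ≡⟨ sum-cong-≗ (λ a → *-distribˡ-sum (χ a) (λ b → χ b * weight a b)) ⟨
    ∑[ a < n ] (χ a * ∑[ b < n ] (χ b * weight a b))
      ≡⟨ sum-cong-≗ (λ a → cong (χ a *_) (wdeg-∑ a S)) ⟨
    ∑[ a < n ] (χ a * wdeg G a S) ∎
    where
    open ≡-Reasoning
    χ : Fin n → ℚ
    χ a = 𝟙 (lookup S a)
    F : Fin n → Fin n → ℚ
    F a b = χ a * (χ b * weight a b)
    F-sym : ∀ a b → F a b ≡ F b a
    F-sym a b = trans (x∙yz≈y∙xz (χ a) (χ b) (weight a b)) (cong (λ x → χ b * (χ a * x)) (weight-sym a b))
    F-diag : ∀ a → F a a ≡ 0ℚ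
    F-diag a = trans (cong (λ x → χ a * (χ a * x)) (weight-diag a))
                     (trans (cong (χ a *_) (*-zeroʳ (χ a))) (*-zeroʳ (χ a)))

  wdeg-─⁅⁆ : ∀ a S v → wdeg G a S ≡ wdeg G a (S ─ ⁅ v ⁆) + 𝟙 (lookup S v) * weight a v
  wdeg-─⁅⁆ a S v = begin
    wdeg G a S                                                 ≡⟨ wdeg-∑ a S ⟩
    ∑[ u < n ] (𝟙 (lookup S u) * weight a u)                    ≡⟨ ∑-─⁅⁆ S v (weight a) ⟩
    ∑[ u < n ] (𝟙 (lookup S′ u) * weight a u) + t * weight a v  ≡⟨ cong (_+ t * weight a v) (wdeg-∑ a S′) ⟨
    wdeg G a S′ + t * weight a v                               ∎
    where
    open ≡-Reasoning
    S′ = S ─ ⁅ v ⁆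
    t = 𝟙 (lookup S v)

  wdeg-─⁅self⁆ : ∀ S v → wdeg G v (S ─ ⁅ v ⁆) ≡ wdeg G v S
  wdeg-─⁅self⁆ S v = sym (begin
    wdeg G v S                     ≡⟨ wdeg-─⁅⁆ v S v ⟩
    wdeg G v S′ + t * weight v v   ≡⟨ cong (λ x → wdeg G v S′ + t * x) (weight-diag v) ⟩
    wdeg G v S′ + t * 0ℚ           ≡⟨ cong (_+_ (wdeg G v S′)) (*-zeroʳ t) ⟩
    wdeg G v S′ + 0ℚ               ≡⟨ +-identityʳ (wdeg G v S′) ⟩
    wdeg G v S′                    ∎)
    where
    open ≡-Reasoning
    S′ = S ─ ⁅ v ⁆
    t = 𝟙 (lookup S v)

  ∑-𝟙-weight : ∀ S v → ∑[ a < n ] (𝟙 (lookup S a) * weight a v) ≡ wdeg G v S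
  ∑-𝟙-weight S v = trans (sum-cong-≗ λ a → cong (𝟙 (lookup S a) *_) (weight-sym a v)) (sym (wdeg-∑ v S))

  -- Proved for doubled sides, where the handshake identity turns W into a sum of degrees.
  totalW-─⁅⁆ : ∀ S v → totalW G S ≡ totalW G (S ─ ⁅ v ⁆) + 𝟙 (lookup S v) * wdeg G v S
  totalW-─⁅⁆ S v = +-double-injective (begin
    totalW G S + totalW G S
      ≡⟨ handshake S ⟩
    ∑[ a < n ] (𝟙 (lookup S a) * wdeg G a S)
      ≡⟨ ∑-─⁅⁆ S v (λ a → wdeg G a S) ⟩
    ∑[ a < n ] (χ′ a * wdeg G a S) + t * D
      ≡⟨ cong (_+ t * D) (sum-cong-≗ expand) ⟩
    ∑[ a < n ] (χ′ a * wdeg G a S′ + t * (χ′ a * weight a v)) + t * D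
      ≡⟨ cong (_+ t * D) (∑-distrib-+ (λ a → χ′ a * wdeg G a S′) (λ a → t * (χ′ a * weight a v))) ⟩
    ∑[ a < n ] (χ′ a * wdeg G a S′) + ∑[ a < n ] (t * (χ′ a * weight a v)) + t * D
      ≡⟨ cong (λ x → ∑[ a < n ] (χ′ a * wdeg G a S′) + x + t * D)
              (*-distribˡ-sum t (λ a → χ′ a * weight a v)) ⟨
    ∑[ a < n ] (χ′ a * wdeg G a S′) + t * ∑[ a < n ] (χ′ a * weight a v) + t * D
      ≡⟨ cong₂ (λ x y → x + t * y + t * D) (handshake S′) (sym (∑-𝟙-weight S′ v)) ⟨
    (totalW G S′ + totalW G S′) + t * wdeg G v S′ + t * D
      ≡⟨ cong (λ x → (totalW G S′ + totalW G S′) + t * x + t * D) (wdeg-─⁅self⁆ S v) ⟩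
    (totalW G S′ + totalW G S′) + t * D + t * D
      ≡⟨ ℚ.+-assoc (totalW G S′ + totalW G S′) (t * D) (t * D) ⟩
    (totalW G S′ + totalW G S′) + (t * D + t * D)
      ≡⟨ +-interchange (totalW G S′) (totalW G S′) (t * D) (t * D) ⟩
    (totalW G S′ + t * D) + (totalW G S′ + t * D) ∎)
    where
    open ≡-Reasoning
    S′ = S ─ ⁅ v ⁆
    t = 𝟙 (lookup S v)
    D = wdeg G v S
    χ′ : Fin n → ℚ
    χ′ a = 𝟙 (lookup S′ a)
    expand : ∀ a → χ′ a * wdeg G a S ≡ χ′ a * wdeg G a S′ + t * (χ′ a * weight a v)
    expand a = begin
      χ′ a * wdeg G a S
        ≡⟨ cong (χ′ a *_) (wdeg-─⁅⁆ a S v) ⟩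
      χ′ a * (wdeg G a S′ + t * weight a v)
        ≡⟨ ℚ.*-distribˡ-+ (χ′ a) (wdeg G a S′) (t * weight a v) ⟩
      χ′ a * wdeg G a S′ + χ′ a * (t * weight a v)
        ≡⟨ cong (_+_ (χ′ a * wdeg G a S′)) (x∙yz≈y∙xz (χ′ a) t (weight a v)) ⟩
      χ′ a * wdeg G a S′ + t * (χ′ a * weight a v) ∎

  wdeg-mono : ∀ {S T} v → S ⊆ T → wdeg G v S ℚ.≤ wdeg G v T
  wdeg-mono {S} {T} v S⊆T = subst₂ ℚ._≤_ (sym (wdeg-∑ v S)) (sym (wdeg-∑ v T))
    (∑-mono-≤ λ u → ℚ.*-monoʳ-≤-nonNeg (weight v u) {{ℚ.nonNegative (weight-nonneg v u)}} (𝟙-mono-⊆ S⊆T u))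

  wdeg-nonneg : ∀ v S → 0ℚ ℚ.≤ wdeg G v S
  wdeg-nonneg v S = subst (0ℚ ℚ.≤_) (sym (wdeg-∑ v S))
    (∑-nonneg λ u → *-nonneg (𝟙-nonneg (lookup S u)) (weight-nonneg v u))

  totalW-nonneg : ∀ S → 0ℚ ℚ.≤ totalW G S
  totalW-nonneg S = +-double-cancel-≤ (subst₂ ℚ._≤_ (sym (+-identityʳ 0ℚ)) (sym (handshake S))
    (∑-nonneg λ a → *-nonneg (𝟙-nonneg (lookup S a)) (wdeg-nonneg a S)))

  totalW-mono : ∀ {S T} → S ⊆ T → totalW G S ℚ.≤ totalW G T
  totalW-mono {S} {T} S⊆T = +-double-cancel-≤ (subst₂ ℚ._≤_ (sym (handshake S)) (sym (handshake T))
    (∑-mono-≤ λ a → ℚ.≤-trans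
      (ℚ.*-monoˡ-≤-nonNeg (𝟙 (lookup S a)) {{ℚ.nonNegative (𝟙-nonneg (lookup S a))}} (wdeg-mono a S⊆T))
      (ℚ.*-monoʳ-≤-nonNeg (wdeg G a T) {{ℚ.nonNegative (wdeg-nonneg a T)}} (𝟙-mono-⊆ S⊆T a))))

  MinDegree≥ : ℚ → Subset n → Set
  MinDegree≥ c S = ∀ u → lookup S u ≡ true → c ℚ.≤ wdeg G u S

  handshake-minDegree : ∀ {c S} → MinDegree≥ c S → fromℕ ∣ S ∣ * c ℚ.≤ totalW G S + totalW G S
  handshake-minDegree {c} {S} c≤deg = subst₂ ℚ._≤_ (∑-𝟙 S c) (sym (handshake S))
    (∑-mono-≤ λ u → 𝟙-*-mono-≤ (lookup S u) (c≤deg u))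

  excess : ℚ → Subset n → ℚ
  excess c S = totalW G S - fromℕ ∣ S ∣ * c

  excess-─⁅⁆ : ∀ {c S} v → wdeg G v S ℚ.≤ c → excess c S ℚ.≤ excess c (S ─ ⁅ v ⁆)
  excess-─⁅⁆ {c} {S} v deg≤c = begin
    excess c S
      ≡⟨ cong₂ _-_ (totalW-─⁅⁆ S v) (fromℕ-∣─⁅⁆∣ S v c) ⟩
    (totalW G S′ + 𝟙 t * wdeg G v S) - (fromℕ ∣ S′ ∣ * c + 𝟙 t * c)
      ≤⟨ ℚ.+-monoˡ-≤ _ (ℚ.+-monoʳ-≤ (totalW G S′) (𝟙-*-mono-≤ t (λ _ → deg≤c))) ⟩
    (totalW G S′ + 𝟙 t * c) - (fromℕ ∣ S′ ∣ * c + 𝟙 t * c)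
      ≡⟨ cancel (totalW G S′) (fromℕ ∣ S′ ∣ * c) (𝟙 t * c) ⟩
    excess c S′ ∎
    where
    open ℚ.≤-Reasoning
    S′ = S ─ ⁅ v ⁆
    t = lookup S v
    cancel : ∀ a b y → (a + y) - (b + y) ≡ a - b
    cancel = solve 3 (λ a b y → (a :+ y) :- (b :+ y) := a :- b) refl

  excess-∩-─⁅⁆ : ∀ {c} S T v → wdeg G v T ℚ.≤ c →
    excess c (S ∩ T) ℚ.≤ excess c (S ∩ (T ─ ⁅ v ⁆))
  excess-∩-─⁅⁆ {c} S T v deg≤c =
    subst (λ X → excess c (S ∩ T) ℚ.≤ excess c X) (sym (∩-─-assoc S T ⁅ v ⁆))
      (excess-─⁅⁆ {S = S ∩ T} v (ℚ.≤-trans (wdeg-mono v (p∩q⊆q S T)) deg≤c))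

  density-nonneg : ∀ S → 0ℚ ℚ.≤ density G S
  density-nonneg S = *-nonneg (totalW-nonneg S) (inv-nonneg ∣ S ∣)

  totalW≡∣∣*density : ∀ S → 1 ≤ ∣ S ∣ → totalW G S ≡ fromℕ ∣ S ∣ * density G S
  totalW≡∣∣*density S 1≤∣S∣ = sym (fromℕ-*-*-inv 1≤∣S∣ (totalW G S))

  ≤-density : ∀ {x} S → 1 ≤ ∣ S ∣ → fromℕ ∣ S ∣ * x ℚ.≤ totalW G S → x ℚ.≤ density G S
  ≤-density {x} S 1≤∣S∣ ∣S∣x≤W = subst (ℚ._≤ density G S)
    (trans (ℚ.*-assoc (fromℕ ∣ S ∣) x (inv ∣ S ∣)) (fromℕ-*-*-inv 1≤∣S∣ x))
    (ℚ.*-monoʳ-≤-nonNeg (inv ∣ S ∣) {{ℚ.nonNegative (inv-nonneg ∣ S ∣)}} ∣S∣x≤W)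

  minDegree≥⇒density≥ : ∀ {x} S → 1 ≤ ∣ S ∣ → MinDegree≥ (x + x) S → x ℚ.≤ density G S
  minDegree≥⇒density≥ {x} S 1≤∣S∣ highMinDeg = ≤-density S 1≤∣S∣ (+-double-cancel-≤
    (subst (ℚ._≤ totalW G S + totalW G S) (ℚ.*-distribˡ-+ (fromℕ ∣ S ∣) x x)
      (handshake-minDegree {S = S} highMinDeg)))

  excess-thirds : ∀ {t} S → 1 ≤ ∣ S ∣ → density G S ≡ t + t + t → excess (t + t) S ≡ fromℕ ∣ S ∣ * t
  excess-thirds {t} S 1≤∣S∣ d≡3t = begin
    totalW G S - s * (t + t)          ≡⟨ cong (_- s * (t + t)) (totalW≡∣∣*density S 1≤∣S∣) ⟩
    s * density G S - s * (t + t)     ≡⟨ cong (λ d → s * d - s * (t + t)) d≡3t ⟩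
    s * (t + t + t) - s * (t + t)     ≡⟨ solve 2 (λ s t → s :* (t :+ t :+ t) :- s :* (t :+ t) := s :* t) refl s t ⟩
    s * t                             ∎
    where
    open ≡-Reasoning
    s = fromℕ ∣ S ∣

  excess-grows⇒density≥ : ∀ {t} S T → 0ℚ ℚ.≤ t → density G S ≡ t + t + t →
    1 ≤ ∣ T ∣ → ∣ T ∣ ≤ ∣ S ∣ → excess (t + t) S ℚ.≤ excess (t + t) (S ∩ T) →
    t ℚ.≤ density G T
  excess-grows⇒density≥ {t} S T 0≤t d≡3t 1≤∣T∣ ∣T∣≤∣S∣ grows = ≤-density T 1≤∣T∣ (begin
    fromℕ ∣ T ∣ * t             ≤⟨ ℚ.*-monoʳ-≤-nonNeg t {{ℚ.nonNegative 0≤t}} (fromℕ-mono ∣T∣≤∣S∣) ⟩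
    fromℕ ∣ S ∣ * t             ≡⟨ excess-thirds {t} S (ℕₚ.≤-trans 1≤∣T∣ ∣T∣≤∣S∣) d≡3t ⟨
    excess (t + t) S            ≤⟨ grows ⟩
    excess (t + t) (S ∩ T)      ≤⟨ x-y≤x (*-nonneg (fromℕ-nonneg ∣ S ∩ T ∣) (ℚ.+-mono-≤ 0≤t 0≤t)) ⟩
    totalW G (S ∩ T)            ≤⟨ totalW-mono (p∩q⊆q S T) ⟩
    totalW G T                  ∎)
    where open ℚ.≤-Reasoning

module ChALK {n} {G : WGraph n} {H : ℕ → Subset n} (run : ChALKRun G H) where
  open ChALKRun run

  ∣H∣ : ∀ {i} → i ≤ n → ∣ H i ∣ ≡ i
  ∣H∣ = downward-induction (λ i → ∣ H i ∣ ≡ i) (trans (cong ∣_∣ start) (∣⊤∣≡n n)) peel-one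
    where
    peel-one : ∀ {i} → i < n → ∣ H (suc i) ∣ ≡ suc i → ∣ H i ∣ ≡ i
    peel-one {i} i<n ∣H[1+i]∣≡1+i with step i i<n
    ... | v , v∈H , _ , H-i = ℕₚ.suc-injective (begin
      suc ∣ H i ∣                     ≡⟨ cong (suc ∘ ∣_∣) H-i ⟩
      suc ∣ H (suc i) ─ ⁅ v ⁆ ∣        ≡⟨ ∣p∣≡1+∣p─⁅v⁆∣ (H (suc i)) v∈H ⟨
      ∣ H (suc i) ∣                   ≡⟨ ∣H[1+i]∣≡1+i ⟩
      suc i                           ∎)
      where open ≡-Reasoning

  HighMinDegreeFrom : ℚ → ℕ → Set
  HighMinDegreeFrom c i = ∃[ j ] i ≤ j × j ≤ n × MinDegree≥ G c (H j)

  highMinDegree⊎excess-grows : ∀ c S {i} → i ≤ n →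
    HighMinDegreeFrom c i ⊎ excess G c S ℚ.≤ excess G c (S ∩ H i)
  highMinDegree⊎excess-grows c S = downward-induction _ initial remove
    where
    initial : HighMinDegreeFrom c n ⊎ excess G c S ℚ.≤ excess G c (S ∩ H n)
    initial = inj₂ (ℚ.≤-reflexive (cong (excess G c) (trans (sym (∩-identityʳ S)) (cong (S ∩_) (sym start)))))
    remove : ∀ {i} → i < n →
      HighMinDegreeFrom c (suc i) ⊎ excess G c S ℚ.≤ excess G c (S ∩ H (suc i)) →
      HighMinDegreeFrom c i ⊎ excess G c S ℚ.≤ excess G c (S ∩ H i)
    remove {i} i<n (inj₁ (j , i<j , j≤n , highMinDeg)) = inj₁ (j , ℕₚ.<⇒≤ i<j , j≤n , highMinDeg)
    remove {i} i<n (inj₂ grows) with step i i<n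
    ... | v , v∈H , v-min , H-i with c ℚ.≤? wdeg G v (H (suc i))
    ...   | yes c≤deg = inj₁ (suc i , ℕₚ.n≤1+n i , i<n , λ u u∈H → ℚ.≤-trans c≤deg (v-min u u∈H))
    ...   | no  c≰deg = inj₂ (ℚ.≤-trans grows
                (subst (λ T → excess G c (S ∩ H (suc i)) ℚ.≤ excess G c (S ∩ T)) (sym H-i)
                  (excess-∩-─⁅⁆ G S (H (suc i)) v (ℚ.<⇒≤ (ℚ.≰⇒> c≰deg)))))

  ∃H-density≥ : ∀ {k t} S → 1 ≤ k → k ≤ n → k ≤ ∣ S ∣ → 0ℚ ℚ.≤ t → density G S ≡ t + t + t →
    ∃[ j ] k ≤ j × j ≤ n × t ℚ.≤ density G (H j)
  ∃H-density≥ {k} {t} S 1≤k k≤n k≤∣S∣ 0≤t d≡3t with highMinDegree⊎excess-grows (t + t) S k≤n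
  ... | inj₁ (j , k≤j , j≤n , highMinDeg) =
    j , k≤j , j≤n ,
    minDegree≥⇒density≥ G (H j) (subst (1 ≤_) (sym (∣H∣ j≤n)) (ℕₚ.≤-trans 1≤k k≤j)) highMinDeg
  ... | inj₂ grows =
    k , ℕₚ.≤-refl , k≤n , excess-grows⇒density≥ G S (H k) 0≤t d≡3t
      (subst (1 ≤_) (sym (∣H∣ k≤n)) 1≤k) (subst (_≤ ∣ S ∣) (sym (∣H∣ k≤n)) k≤∣S∣) grows

⅓ : ℚ
⅓ = + 1 / 3

thirds : ∀ d → d ≡ d * ⅓ + d * ⅓ + d * ⅓
thirds = solve 1 (λ d → d := d :* con ⅓ :+ d :* con ⅓ :+ d :* con ⅓) refl

0≤⅓ : 0ℚ ℚ.≤ ⅓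
0≤⅓ = ℚ.≤ᵇ⇒≤ _

dal-*-lub : ∀ {n} (G : WGraph n) k {r D} → 0ℚ ℚ.≤ r → 0ℚ ℚ.≤ D →
  (∀ S → k ≤ ∣ S ∣ → density G S * r ℚ.≤ D) → dal G k * r ℚ.≤ D
dal-*-lub {n} G k {r} {D} 0≤r 0≤D bound = go (allSubsets n)
  where
  fold : List (Subset n) → ℚ
  fold = foldr (λ S m → if k ℕ.≤ᵇ ∣ S ∣ then density G S ℚ.⊔ m else m) 0ℚ
  go : ∀ Ss → fold Ss * r ℚ.≤ D
  go []       = subst (ℚ._≤ D) (sym (*-zeroˡ r)) 0≤D
  go (S ∷ Ss) with k ℕ.≤ᵇ ∣ S ∣ in k≤ᵇ∣S∣
  ... | true  = subst (ℚ._≤ D) (sym (ℚ.*-distribʳ-⊔-nonNeg r {{ℚ.nonNegative 0≤r}} (density G S) (fold Ss)))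
                  (ℚ.⊔-lub (bound S (ℕₚ.≤ᵇ⇒≤ k ∣ S ∣ (subst T (sym k≤ᵇ∣S∣) _))) (go Ss))
  ... | false = go Ss

theorem1 : (n : ℕ) (G : WGraph n) (k : ℕ) → 1 ≤ k → k ≤ n →
    (H : ℕ → Subset n) → ChALKRun G H →
    (i : ℕ) → ChALKOutput G k H i →
    (k ≤ ∣ H i ∣) × (dal G k * ((+ 1) / 3) ℚ.≤ density G (H i))
theorem1 n G k 1≤k k≤n H run i out =
    subst (k ≤_) (sym (∣H∣ i≤n)) k≤i
  , dal-*-lub G k 0≤⅓ (density-nonneg G (H i)) λ S k≤∣S∣ →
      let j , k≤j , j≤n , d/3≤dH = ∃H-density≥ S 1≤k k≤n k≤∣S∣
                                     (*-nonneg (density-nonneg G S) 0≤⅓) (thirds (density G S))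
      in ℚ.≤-trans d/3≤dH (best j k≤j j≤n)
  where
  open ChALK run
  open ChALKOutput out
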